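{- Let $k\ge 1$ be an integer. Define a function $C:\mathbb{Z}^2\to\mathbb{Z}$ as follows. For $(x,y)$ with $x<0$ or $y<0$ set $$C(x,y)=\begin{cases} k & \text{if } x<0 \text{ and } y<0,\\ 0 & \text{if } x<0 \text{ and } y\ge 0,\\ 0 & \text{if } x\ge 0 \text{ and } y<0.\end{cases}$$ For $x,y\ge 0$ define $C(x,y)$ recursively (e.g. by induction on $x+y$) by $$C(x,y)=a-b-c+e+f+p,$$ where $a=C(x-2,y-2)$, $b=C(x-2,y-1)$, $c=C(x-1,y-2)$, $d=C(x-1,y-1)$, $e=C(x-1,y)$, $f=C(x,y-1)$, and $$p=3\,[a<0]-2\,[b<0]-2\,[c<0]-[d<0]+[e<0]+[f<0],$$ with $[\cdot]$ denoting the Iverson bracket ($1$ if the condition holds, $0$ otherwise). Then for all nonnegative integers $x,y$, the position $(x,y)$ of $k$-Blocking Wythoff Nim is a P-position if and only if $C(x,y)<0$.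
   Context: $k$-Blocking Wythoff Nim (for a fixed integer $k\ge1$): positions are pairs $(x,y)$ of nonnegative integers (two heap sizes, equivalently the position of a queen on a quadrant chessboard). The options of $(x,y)$ are the positions $(x-t,y)$, $(x,y-t)$, $(x-t,y-t)$ for integers $t\ge 1$ with all coordinates remaining nonnegative. Two players alternate turns. On each turn the mover chooses an option of the current position, but before doing so the opponent (the player who made the previous move) may designate up to $k-1$ of the options as blocked, and the mover must choose a non-blocked option. A player who has no available (non-blocked) option loses. A position $(x,y)$ is a P-position if the player who moves the game into $(x,y)$ (and who then gets to block up to $k-1$ options of $(x,y)$) has a winning strategy. Equivalently, the set $P$ of P-positions is characterized by: $(x,y)\in P$ if and only if fewer than $k$ of the options of $(x,y)$ belong to $P$. -}

module Defs where

open import Data.Nat as ℕ using (ℕ; zero; suc; _∸_; _⊓_)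
open import Data.Bool using (Bool; true; false; if_then_else_)
open import Data.Integer as ℤ using (ℤ; +_; _+_; _-_; _*_; _<_; _<?_)
open import Data.List using (List; []; _∷_; _++_; map; upTo; length; filterᵇ)
open import Data.Product using (_×_; _,_; uncurry)
open import Relation.Nullary.Decidable using (⌊_⌋)

options : ℕ → ℕ → List (ℕ × ℕ)
options x y =
  map (λ t → (x ∸ suc t , y)) (upTo x)
  ++ map (λ t → (x , y ∸ suc t)) (upTo y)
  ++ map (λ t → (x ∸ suc t , y ∸ suc t)) (upTo (x ⊓ y))

countOptionsIn : (ℕ → ℕ → Bool) → ℕ → ℕ → ℕ
countOptionsIn S x y = length (filterᵇ (uncurry S) (options x y))

-- S is the set of P-positions of k-Blocking Wythoff Nim:
-- (x , y) ∈ S iff fewer than k options of (x , y) belong to S.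
-- (This characterization determines S uniquely, by induction on x + y.)
IsPSet : ℕ → (ℕ → ℕ → Bool) → Set
IsPSet k S = ∀ x y → (S x y ≡ true → countOptionsIn S x y ℕ.< k)
                   × (countOptionsIn S x y ℕ.< k → S x y ≡ true)
  where open import Relation.Binary.PropositionalEquality using (_≡_)

neg : ℤ → ℤ
neg z = if ⌊ z <? + 0 ⌋ then + 1 else + 0

-- D k i j = C (i - 2 , j - 2), where C is the function of the paper.
D : ℕ → ℕ → ℕ → ℤ
D k zero          zero          = + k
D k zero          (suc zero)    = + k
D k (suc zero)    zero          = + k
D k (suc zero)    (suc zero)    = + k
D k zero          (suc (suc j)) = + 0
D k (suc zero)    (suc (suc j)) = + 0
D k (suc (suc i)) zero          = + 0
D k (suc (suc i)) (suc zero)    = + 0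
D k (suc (suc i)) (suc (suc j)) =
  let a = D k i j
      b = D k i (suc j)
      c = D k (suc i) j
      d = D k (suc i) (suc j)
      e = D k (suc i) (suc (suc j))
      f = D k (suc (suc i)) (suc j)
      p = + 3 * neg a - + 2 * neg b - + 2 * neg c - neg d + neg e + neg f
  in a - b - c + e + f + p

C : ℕ → ℕ → ℕ → ℤ
C k x y = D k (suc (suc x)) (suc (suc y))

-- Let N (x, y) be the number of options of (x, y) that are P-positions. By the defining
-- property, (x, y) is a P-position iff N (x, y) - k < 0, so it suffices to show C = N - k.
-- The options of (x, y) lie on its row, column and diagonal, so N is a sum of three prefix
-- sums of the indicator of P along these lines. Each prefix sum changes by one indicator value
-- per step, and eliminating the prefix sums between N at (x, y) and at the five neighbours
-- (x-2, y-2), (x-2, y-1), (x-1, y-2), (x-1, y), (x, y-1) leaves exactly the bracket term p,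
-- since by induction [C < 0] is the indicator of P at these neighbours. Extending N to negative
-- coordinates by k for each negative coordinate makes N - k agree with the initial values of C.
module Submission where

open import Defs
open import Data.Nat using (ℕ; _≤_)
open import Data.Bool using (Bool; true)
open import Data.Integer using (+_) renaming (_<_ to _<ℤ_)
open import Data.Product using (_×_)
open import Relation.Binary.PropositionalEquality using (_≡_)

open import Algebra.Properties.AbelianGroup using (xyx⁻¹≈y; //-rightDividesʳ)
open import Data.Bool using (false; if_then_else_)
open import Data.Integer using (ℤ; _+_; _-_; _*_; _⊖_; -<+) renaming (_<?_ to _<ℤ?_)
open import Data.Integer.Properties
  using (+-0-abelianGroup; +-assoc; +-identityˡ; +-identityʳ; pos-+; +≮0; m-n≡m⊖n; ⊖-≥; [1+m]⊖[1+n]≡m⊖n)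
open import Data.Integer.Tactic.RingSolver using (solve-∀)
open import Data.List using (List; _∷_; _++_; map; upTo; length; filterᵇ)
open import Data.List.Properties using (filter-++; length-++; map-applyUpTo; map-upTo)
import Data.Nat as ℕ
open import Data.Nat using (zero; suc; _∸_; _⊓_; _<_; _<?_; z≤n; s≤s)
open import Data.Nat.Properties using (≮⇒≥; ≤-trans; n≤1+n)
open import Data.Product using (_,_; uncurry)
open import Data.Sum using (_⊎_; inj₁; inj₂; map₁; map₂)
open import Function using (_∘_; _⇔_; mk⇔; Equivalence)
open import Function.Construct.Composition using (_⇔-∘_)
open import Function.Construct.Symmetry using (⇔-sym)
open import Relation.Binary.PropositionalEquality using (refl; sym; trans; cong; cong₂; subst; module ≡-Reasoning)
open import Relation.Nullary using (yes; no; contradiction)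
open import Relation.Nullary.Decidable using (T?)

open Equivalence using (to; from)

m⊖n<0 : ∀ {m n} → m < n → m ⊖ n <ℤ + 0
m⊖n<0 {zero}  {suc n} _         = -<+
m⊖n<0 {suc m} {suc n} (s≤s m<n) = subst (_<ℤ + 0) (sym ([1+m]⊖[1+n]≡m⊖n m n)) (m⊖n<0 m<n)

+m-+n<0⇔m<n : ∀ m n → (+ m - + n <ℤ + 0) ⇔ m < n
+m-+n<0⇔m<n m n = mk⇔ m-n<0⇒m<n m<n⇒m-n<0
  where
  m<n⇒m-n<0 : m < n → + m - + n <ℤ + 0
  m<n⇒m-n<0 m<n = subst (_<ℤ + 0) (sym (m-n≡m⊖n m n)) (m⊖n<0 m<n)

  m-n<0⇒m<n : + m - + n <ℤ + 0 → m < n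
  m-n<0⇒m<n m-n<0 with m <? n
  ... | yes m<n = m<n
  ... | no  m≮n = contradiction (subst (_<ℤ + 0) (trans (m-n≡m⊖n m n) (⊖-≥ (≮⇒≥ m≮n))) m-n<0) +≮0

iverson : Bool → ℤ
iverson b = if b then + 1 else + 0

neg≡iverson : ∀ {b} z → (b ≡ true ⇔ z <ℤ + 0) → neg z ≡ iverson b
neg≡iverson {true}  z b⇔z<0 with z <ℤ? + 0
... | yes _   = refl
... | no  z≮0 = contradiction (to b⇔z<0 refl) z≮0
neg≡iverson {false} z b⇔z<0 with z <ℤ? + 0
... | yes z<0 = contradiction (from b⇔z<0 z<0) λ ()
... | no  _   = refl

neg-+ : ∀ n → neg (+ n) ≡ + 0
neg-+ n = neg≡iverson {false} (+ n) (mk⇔ (λ ()) (λ n<0 → contradiction n<0 +≮0))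

brackets : ℤ → ℤ → ℤ → ℤ → ℤ → ℤ → ℤ
brackets a b c d e f = + 3 * a - + 2 * b - + 2 * c - d + e + f

recurrence : ℤ → ℤ → ℤ → ℤ → ℤ → ℤ → ℤ
recurrence a b c d e f = a - b - c + e + f + brackets (neg a) (neg b) (neg c) (neg d) (neg e) (neg f)

recurrence-cong : ∀ {a b c d e f a′ b′ c′ d′ e′ f′} →
  a ≡ a′ → b ≡ b′ → c ≡ c′ → d ≡ d′ → e ≡ e′ → f ≡ f′ → recurrence a b c d e f ≡ recurrence a′ b′ c′ d′ e′ f′
recurrence-cong refl refl refl refl refl refl = refl

-- The coefficients 1, -1, -1, 1, 1 of the linear part sum to 1, so a common shift passes through it.
recurrence-shift : ∀ a b c d e f K {xa xb xc xd xe xf} →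
  neg (a - K) ≡ xa → neg (b - K) ≡ xb → neg (c - K) ≡ xc →
  neg (d - K) ≡ xd → neg (e - K) ≡ xe → neg (f - K) ≡ xf →
  recurrence (a - K) (b - K) (c - K) (d - K) (e - K) (f - K)
    ≡ a - b - c + e + f + brackets xa xb xc xd xe xf - K
recurrence-shift a b c d e f K refl refl refl refl refl refl =
  shift a b c e f (brackets (neg (a - K)) (neg (b - K)) (neg (c - K)) (neg (d - K)) (neg (e - K)) (neg (f - K))) K
  where
  shift : ∀ a b c e f p K → (a - K) - (b - K) - (c - K) + (e - K) + (f - K) + p ≡ a - b - c + e + f + p - K
  shift = solve-∀

module _ {A : Set} (p : A → Bool) where

  count : List A → ℤ
  count xs = + length (filterᵇ p xs)

  count-∷ : ∀ x xs → count (x ∷ xs) ≡ iverson (p x) + count xs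
  count-∷ x xs with p x
  ... | true  = refl
  ... | false = refl

  count-++ : ∀ xs ys → count (xs ++ ys) ≡ count xs + count ys
  count-++ xs ys = begin
    + length (filterᵇ p (xs ++ ys))                    ≡⟨ cong (+_ ∘ length) (filter-++ (T? ∘ p) xs ys) ⟩
    + length (filterᵇ p xs ++ filterᵇ p ys)            ≡⟨ cong +_ (length-++ (filterᵇ p xs)) ⟩
    + (length (filterᵇ p xs) ℕ.+ length (filterᵇ p ys)) ≡⟨ pos-+ (length (filterᵇ p xs)) (length (filterᵇ p ys)) ⟩
    count xs + count ys                                ∎
    where open ≡-Reasoning

  count-upTo-suc : ∀ (f : ℕ → A) n →
    count (map f (upTo (suc n))) ≡ iverson (p (f 0)) + count (map (f ∘ suc) (upTo n))
  count-upTo-suc f n = trans (count-∷ (f 0) _)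
    (cong (λ xs → iverson (p (f 0)) + count xs) (trans (map-applyUpTo suc f n) (sym (map-upTo (f ∘ suc) n))))

rowOptions colOptions diagOptions : ℕ → ℕ → List (ℕ × ℕ)
rowOptions  x y = map (λ t → (x ∸ suc t , y)) (upTo x)
colOptions  x y = map (λ t → (x , y ∸ suc t)) (upTo y)
diagOptions x y = map (λ t → (x ∸ suc t , y ∸ suc t)) (upTo (x ⊓ y))

-- As in D, index (i , j) stands for the position (i - 2 , j - 2); the indices in the padding
-- model negative coordinates.
Padding : ℕ → ℕ → Set
Padding i j = i ≤ 1 ⊎ j ≤ 1

Padding-predˡ : ∀ {i j} → Padding (suc i) j → Padding i j
Padding-predˡ = map₁ (≤-trans (n≤1+n _))

Padding-predʳ : ∀ {i j} → Padding i (suc j) → Padding i j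
Padding-predʳ = map₂ (≤-trans (n≤1+n _))

module OptionCount (k : ℕ) (S : ℕ → ℕ → Bool) where

  χ : ℕ → ℕ → ℤ
  χ (suc (suc i)) (suc (suc j)) = iverson (S i j)
  χ _             _             = + 0

  rowSum colSum diagSum : ℕ → ℕ → ℤ
  rowSum zero    j = + 0
  rowSum (suc i) j = χ i j + rowSum i j
  colSum i zero    = + 0
  colSum i (suc j) = χ i j + colSum i j
  diagSum (suc i) (suc j) = χ i j + diagSum i j
  diagSum _       _       = + 0

  border : ℕ → ℕ
  border zero          = k
  border (suc zero)    = k
  border (suc (suc _)) = 0

  N : ℕ → ℕ → ℤ
  N i j = rowSum i j + colSum i j + diagSum i j + (+ border i + + border j)

  χ-padding : ∀ {i j} → Padding i j → χ i j ≡ + 0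
  χ-padding {zero}                      _               = refl
  χ-padding {suc zero}                  _               = refl
  χ-padding {suc (suc i)} {zero}        _               = refl
  χ-padding {suc (suc i)} {suc zero}    _               = refl
  χ-padding {suc (suc i)} {suc (suc j)} (inj₁ (s≤s ()))
  χ-padding {suc (suc i)} {suc (suc j)} (inj₂ (s≤s ()))

  rowSum-padding : ∀ i {j} → Padding i j → rowSum i j ≡ + 0
  rowSum-padding zero    _ = refl
  rowSum-padding (suc i) pad =
    cong₂ _+_ (χ-padding (Padding-predˡ pad)) (rowSum-padding i (Padding-predˡ pad))

  colSum-padding : ∀ {i} j → Padding i j → colSum i j ≡ + 0
  colSum-padding zero    _ = refl
  colSum-padding (suc j) pad =
    cong₂ _+_ (χ-padding (Padding-predʳ pad)) (colSum-padding j (Padding-predʳ pad))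

  diagSum-padding : ∀ i j → Padding i j → diagSum i j ≡ + 0
  diagSum-padding zero    _       _ = refl
  diagSum-padding (suc i) zero    _ = refl
  diagSum-padding (suc i) (suc j) pad =
    cong₂ _+_ (χ-padding pad′) (diagSum-padding i j pad′)
    where
    pad′ : Padding i j
    pad′ = Padding-predˡ (Padding-predʳ pad)

  N-padding : ∀ {i j} → Padding i j → N i j ≡ + border i + + border j
  N-padding {i} {j} pad = trans
    (cong (_+ (+ border i + + border j))
          (cong₂ _+_ (cong₂ _+_ (rowSum-padding i pad) (colSum-padding j pad)) (diagSum-padding i j pad)))
    (+-identityˡ _)

  border-padding : ∀ {i} → i ≤ 1 → border i ≡ k
  border-padding z≤n       = refl
  border-padding (s≤s z≤n) = refl

  N-k-paddingˡ : ∀ {i} j → i ≤ 1 → N i j - + k ≡ + border j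
  N-k-paddingˡ {i} j i≤1 = begin
    N i j - + k                   ≡⟨ cong (_- + k) (N-padding (inj₁ i≤1)) ⟩
    + border i + + border j - + k ≡⟨ cong (λ b → + b + + border j - + k) (border-padding i≤1) ⟩
    + k + + border j - + k        ≡⟨ xyx⁻¹≈y +-0-abelianGroup (+ k) (+ border j) ⟩
    + border j                    ∎
    where open ≡-Reasoning

  N-k-paddingʳ : ∀ i {j} → j ≤ 1 → N i j - + k ≡ + border i
  N-k-paddingʳ i {j} j≤1 = begin
    N i j - + k                   ≡⟨ cong (_- + k) (N-padding (inj₂ j≤1)) ⟩
    + border i + + border j - + k ≡⟨ cong (λ b → + border i + + b - + k) (border-padding j≤1) ⟩
    + border i + + k - + k        ≡⟨ //-rightDividesʳ +-0-abelianGroup (+ k) (+ border i) ⟩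
    + border i                    ∎
    where open ≡-Reasoning

  countS : List (ℕ × ℕ) → ℤ
  countS = count (uncurry S)

  count-rowOptions : ∀ x y → countS (rowOptions x y) ≡ rowSum (suc (suc x)) (suc (suc y))
  count-rowOptions zero    y = refl
  count-rowOptions (suc x) y =
    trans (count-upTo-suc (uncurry S) _ x) (cong (_+_ (iverson (S x y))) (count-rowOptions x y))

  count-colOptions : ∀ x y → countS (colOptions x y) ≡ colSum (suc (suc x)) (suc (suc y))
  count-colOptions x zero    = refl
  count-colOptions x (suc y) =
    trans (count-upTo-suc (uncurry S) _ y) (cong (_+_ (iverson (S x y))) (count-colOptions x y))

  count-diagOptions : ∀ x y → countS (diagOptions x y) ≡ diagSum (suc (suc x)) (suc (suc y))
  count-diagOptions zero    y       = refl
  count-diagOptions (suc x) zero    = sym (cong (_+_ (+ 0)) (diagSum-padding (suc (suc x)) 1 (inj₂ (s≤s z≤n))))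
  count-diagOptions (suc x) (suc y) =
    trans (count-upTo-suc (uncurry S) _ (x ⊓ y)) (cong (_+_ (iverson (S x y))) (count-diagOptions x y))

  count≡N : ∀ x y → + countOptionsIn S x y ≡ N (suc (suc x)) (suc (suc y))
  count≡N x y = begin
    countS (rows ++ cols ++ diags)                  ≡⟨ count-++ (uncurry S) rows (cols ++ diags) ⟩
    countS rows + countS (cols ++ diags)            ≡⟨ cong (_+_ (countS rows)) (count-++ (uncurry S) cols diags) ⟩
    countS rows + (countS cols + countS diags)      ≡⟨ cong₂ _+_ (count-rowOptions x y)
                                                         (cong₂ _+_ (count-colOptions x y) (count-diagOptions x y)) ⟩
    rowSum x₂ y₂ + (colSum x₂ y₂ + diagSum x₂ y₂)   ≡⟨ sym (+-assoc (rowSum x₂ y₂) _ _) ⟩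
    rowSum x₂ y₂ + colSum x₂ y₂ + diagSum x₂ y₂     ≡⟨ sym (+-identityʳ _) ⟩
    N x₂ y₂                                         ∎
    where
    open ≡-Reasoning
    rows cols diags : List (ℕ × ℕ)
    rows = rowOptions x y
    cols = colOptions x y
    diags = diagOptions x y
    x₂ y₂ : ℕ
    x₂ = suc (suc x)
    y₂ = suc (suc y)

  -- The two sides differ by χ(i+1,j+2) + χ(i,j) - χ(i,j+1) - χ(i+1,j+1) in the row sums, by the
  -- transposed amount in the column sums, and by χ(i,j) + χ(i+1,j+1) - χ(i,j+1) - χ(i+1,j) in the
  -- diagonal sums; together this is the bracket term.
  N-recurrence : ∀ i j →
    N (suc (suc i)) (suc (suc j))
      ≡ N i j - N i (suc j) - N (suc i) j + N (suc i) (suc (suc j)) + N (suc (suc i)) (suc j)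
        + brackets (χ i j) (χ i (suc j)) (χ (suc i) j) (χ (suc i) (suc j))
                   (χ (suc i) (suc (suc j))) (χ (suc (suc i)) (suc j))
  N-recurrence i j = identity
    (rowSum i j) (rowSum i (suc j)) (rowSum i (suc (suc j)))
    (colSum i j) (colSum (suc i) j) (colSum (suc (suc i)) j)
    (diagSum i j) (diagSum i (suc j)) (diagSum (suc i) j)
    (+ border i) (+ border (suc i)) (+ border j) (+ border (suc j))
    (χ i j) (χ i (suc j)) (χ i (suc (suc j))) (χ (suc i) j) (χ (suc i) (suc j))
    (χ (suc i) (suc (suc j))) (χ (suc (suc i)) j) (χ (suc (suc i)) (suc j))
    where
    identity : ∀ r₀ r₁ r₂ c₀ c₁ c₂ d₀ d₁ d₂ bi bi′ bj bj′ x₀₀ x₀₁ x₀₂ x₁₀ x₁₁ x₁₂ x₂₀ x₂₁ →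
      x₁₂ + (x₀₂ + r₂) + (x₂₁ + (x₂₀ + c₂)) + (x₁₁ + (x₀₀ + d₀)) + (+ 0 + + 0)
        ≡ r₀ + c₀ + d₀ + (bi + bj)
          - (r₁ + (x₀₀ + c₀) + d₁ + (bi + bj′))
          - (x₀₀ + r₀ + c₁ + d₂ + (bi′ + bj))
          + (x₀₂ + r₂ + (x₁₁ + (x₁₀ + c₁)) + (x₀₁ + d₁) + (bi′ + + 0))
          + (x₁₁ + (x₀₁ + r₁) + (x₂₀ + c₂) + (x₁₀ + d₂) + (+ 0 + bj′))
          + (+ 3 * x₀₀ - + 2 * x₀₁ - + 2 * x₁₀ - x₁₁ + x₁₂ + x₂₁)
    identity = solve-∀

module _ (k : ℕ) (S : ℕ → ℕ → Bool) (isPSet : IsPSet k S) where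
  open OptionCount k S

  S⇔count-k<0 : ∀ x y → S x y ≡ true ⇔ + countOptionsIn S x y - + k <ℤ + 0
  S⇔count-k<0 x y = ⇔-sym (+m-+n<0⇔m<n _ k) ⇔-∘ uncurry mk⇔ (isPSet x y)

  neg[N-k]≡χ : ∀ i j → neg (N i j - + k) ≡ χ i j
  neg[N-k]≡χ zero                j          = trans (cong neg (N-k-paddingˡ j z≤n)) (neg-+ (border j))
  neg[N-k]≡χ (suc zero)          j          = trans (cong neg (N-k-paddingˡ j (s≤s z≤n))) (neg-+ (border j))
  neg[N-k]≡χ i₂@(suc (suc _))    zero       = trans (cong neg (N-k-paddingʳ i₂ z≤n)) (neg-+ 0)
  neg[N-k]≡χ i₂@(suc (suc _))    (suc zero) = trans (cong neg (N-k-paddingʳ i₂ (s≤s z≤n))) (neg-+ 0)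
  neg[N-k]≡χ (suc (suc i)) (suc (suc j)) =
    trans (cong (neg ∘ (_- + k)) (sym (count≡N i j))) (neg≡iverson _ (S⇔count-k<0 i j))

  D≡N-k : ∀ i j → D k i j ≡ N i j - + k
  D≡N-k zero                zero          = sym (N-k-paddingˡ 0 z≤n)
  D≡N-k zero                (suc zero)    = sym (N-k-paddingˡ 1 z≤n)
  D≡N-k zero                (suc (suc j)) = sym (N-k-paddingˡ (suc (suc j)) z≤n)
  D≡N-k (suc zero)          zero          = sym (N-k-paddingˡ 0 (s≤s z≤n))
  D≡N-k (suc zero)          (suc zero)    = sym (N-k-paddingˡ 1 (s≤s z≤n))
  D≡N-k (suc zero)          (suc (suc j)) = sym (N-k-paddingˡ (suc (suc j)) (s≤s z≤n))
  D≡N-k i₂@(suc (suc _))    zero          = sym (N-k-paddingʳ i₂ z≤n)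
  D≡N-k i₂@(suc (suc _))    (suc zero)    = sym (N-k-paddingʳ i₂ (s≤s z≤n))
  D≡N-k (suc (suc i)) (suc (suc j)) =
    trans (recurrence-cong (D≡N-k i j) (D≡N-k i (suc j)) (D≡N-k (suc i) j) (D≡N-k (suc i) (suc j))
                           (D≡N-k (suc i) (suc (suc j))) (D≡N-k (suc (suc i)) (suc j)))
    (trans (recurrence-shift (N i j) (N i (suc j)) (N (suc i) j) (N (suc i) (suc j))
                             (N (suc i) (suc (suc j))) (N (suc (suc i)) (suc j)) (+ k)
                             (neg[N-k]≡χ i j) (neg[N-k]≡χ i (suc j)) (neg[N-k]≡χ (suc i) j)
                             (neg[N-k]≡χ (suc i) (suc j)) (neg[N-k]≡χ (suc i) (suc (suc j)))
                             (neg[N-k]≡χ (suc (suc i)) (suc j)))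
           (cong (_- + k) (sym (N-recurrence i j))))

  S⇔C<0 : ∀ x y → S x y ≡ true ⇔ C k x y <ℤ + 0
  S⇔C<0 x y = subst (λ c → S x y ≡ true ⇔ c <ℤ + 0)
    (trans (cong (_- + k) (count≡N x y)) (sym (D≡N-k (suc (suc x)) (suc (suc y)))))
    (S⇔count-k<0 x y)

theorem1 : (k : ℕ) → 1 ≤ k → (S : ℕ → ℕ → Bool) → IsPSet k S →
    (x y : ℕ) → (S x y ≡ true → C k x y <ℤ + 0) × (C k x y <ℤ + 0 → S x y ≡ true)
theorem1 k _ S isPSet x y = to (S⇔C<0 k S isPSet x y) , from (S⇔C<0 k S isPSet x y)
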